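{- Let $\mathcal{F}$ be the family of finite hypergraphs $H$ such that both $H$ and its dual $H^*$ have VC-dimension at most 2. Then for every integer $r\ge 1$ there is $H\in\mathcal{F}$ all of whose hyperedges have at least $r$ vertices and with $\mathsf{p}(H)=1$; and for every integer $\delta\ge 1$ there is $H\in\mathcal{F}$ in which every vertex has degree at least $\delta$ and with $\mathsf{p}'(H)=1$.
   Context: A hypergraph $H=(V,\mathcal{E})$ has finite vertex set $V$ and a finite multiset $\mathcal{E}$ of subsets of $V$. Its dual $H^*$ has vertex set $\mathcal{E}$ and, for each $v\in V$, a hyperedge $\{E\in\mathcal{E}: v\in E\}$. A set $S\subseteq V$ is shattered if $\{S\cap E: E\in\mathcal{E}\}$ is the set of all subsets of $S$; the VC-dimension is the largest size of a shattered set. A polychromatic $k$-colouring is a map $V\to\{1,\dots,k\}$ such that every hyperedge contains every colour; $\mathsf{p}(H)$ is the maximum such $k$. A set cover is a subfamily of $\mathcal{E}$ with union $V$; $\mathsf{p}'(H)$ is the maximum number of set covers into which $\mathcal{E}$ can be partitioned. -}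

module Defs where

open import Data.Nat using (ℕ; _≤_; _≥_)
open import Data.Fin using (Fin)
open import Data.Fin.Subset using (Subset; _∈_; _⊆_; _∩_; ∣_∣)
open import Data.Vec using (tabulate; lookup)
open import Data.Product using (∃; _×_)
open import Relation.Binary.PropositionalEquality using (_≡_)
open import Relation.Nullary using (¬_)
open import Data.Sum using (_⊎_)

-- A finite hypergraph: vertex set Fin n, and a multiset of m hyperedges,
-- given as an indexed family Fin m → Subset n (repetitions allowed).
record Hypergraph : Set where
  constructor hyp
  field
    n    : ℕ
    m    : ℕ
    edge : Fin m → Subset n
open Hypergraph public

dual : Hypergraph → Hypergraph
dual H = hyp (m H) (n H) (λ v → tabulate (λ i → lookup (edge H i) v))

Shattered : (H : Hypergraph) → Subset (n H) → Set
Shattered H S = ∀ (T : Subset (n H)) → T ⊆ S → ∃ λ i → S ∩ edge H i ≡ T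

VCdim≤ : Hypergraph → ℕ → Set
VCdim≤ H d = ∀ (S : Subset (n H)) → Shattered H S → ∣ S ∣ ≤ d

InF : Hypergraph → Set
InF H = VCdim≤ H 2 × VCdim≤ (dual H) 2

-- Degree of a vertex: number of hyperedges (with multiplicity) containing it.
degree : (H : Hypergraph) → Fin (n H) → ℕ
degree H v = ∣ edge (dual H) v ∣

Polychromatic : (H : Hypergraph) (k : ℕ) → (Fin (n H) → Fin k) → Set
Polychromatic H k c = ∀ (i : Fin (m H)) (j : Fin k) → ∃ λ v → v ∈ edge H i × c v ≡ j

p≡ : Hypergraph → ℕ → Set
p≡ H k = (∃ λ c → Polychromatic H k c)
       × (∀ k' → k' ≥ k → k' ≡ k ⊎ (¬ ∃ λ c → Polychromatic H k' c))

-- A partition of the hyperedges into k classes (f assigns each hyperedge its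
-- class), each of which is a set cover (its union is the whole vertex set).
CoverPartition : (H : Hypergraph) (k : ℕ) → (Fin (m H) → Fin k) → Set
CoverPartition H k f = ∀ (j : Fin k) (v : Fin (n H)) → ∃ λ i → f i ≡ j × v ∈ edge H i

p'≡ : Hypergraph → ℕ → Set
p'≡ H k = (∃ λ f → CoverPartition H k f)
        × (∀ k' → k' ≥ k → k' ≡ k ⊎ (¬ ∃ λ f → CoverPartition H k' f))

module Submission where

-- Both statements are witnessed by one family of hypergraphs and its duals.  For b, D
-- take the complete b-ary tree of depth D; its tree hypergraph has the nodes as vertices
-- and one hyperedge per node: for a leaf, its root-to-leaf path; for an inner node, its
-- set of children.  With b = D = r every hyperedge has at least r vertices, and no
-- colouring with two colours is polychromatic: following children of the root's colour
-- gives a monochromatic root-to-leaf path, which is itself a hyperedge.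

open import Defs
open import Data.Nat using (ℕ; _≥_)
open import Data.Fin using (Fin)
open import Data.Fin.Subset using (∣_∣)
open import Data.Product using (Σ; _×_)

open import Data.Nat using (zero; suc; _≤_; _*_; z≤n; s≤s; _≤?_)
open import Data.Nat.Properties using (≤-refl; ≤-trans; ≤-pred; ≰⇒>; n≤1+n)
open import Data.Fin using (zero; suc; inject≤; remQuot; combine; punchIn)
open import Data.Fin.Patterns using (0F; 1F; 2F)
open import Data.Fin.Properties
  using (_≟_; suc-injective; 0≢1+n; inject≤-injective; remQuot-combine; combine-remQuot; punchInᵢ≢i)
open import Data.Fin.Subset using (Subset; _∈_; _∉_; _⊆_; _-_; Nonempty; Side; inside; outside)
open import Data.Fin.Subset.Properties using (p─⊥≡p; p─q⊆p; x∈p∩q⁺; x∈p∩q⁻; x∈p∧x≢y⇒x∈p-y; x∈p⇒∣p-x∣<∣p∣)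
open import Data.Vec using (_∷_; tabulate; here; there)
open import Data.Vec.Properties using (lookup∘tabulate; []=⇒lookup; lookup⇒[]=)
open import Data.Product using (∃; _,_; proj₁; proj₂)
import Data.Product as Product
open import Data.Sum using (_⊎_; inj₁; inj₂)
import Data.Sum as Sum
open import Data.Empty using (⊥-elim)
open import Function using (id; _∘_; flip; const)
open import Function.Bundles using (_⇔_; mk⇔; Equivalence)
open import Function.Definitions using (Injective)
open import Relation.Nullary using (¬_; Dec; yes; no; does)
open import Relation.Nullary.Decidable using (dec-true; map′)
open import Relation.Unary using (Decidable)
open import Relation.Binary.PropositionalEquality
  using (_≡_; _≢_; refl; sym; trans; cong; subst; module ≡-Reasoning)

open Equivalence using (to; from)

pick : ∀ {n k} (S : Subset n) → suc k ≤ ∣ S ∣ → ∃ λ x → x ∈ S × k ≤ ∣ S - x ∣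
pick (inside ∷ S) (s≤s k≤∣S∣) = zero , here , subst (_ ≤_) (cong ∣_∣ (sym (p─⊥≡p S))) k≤∣S∣
pick (outside ∷ S) k<∣S∣ with pick S k<∣S∣
... | x , x∈S , k≤ = suc x , there x∈S , k≤

x∉S-x : ∀ {n} {x : Fin n} {S : Subset n} → x ∉ S - x
x∉S-x {x = suc x} {_ ∷ S} (there x∈) = x∉S-x x∈

Embeds : ∀ {n} → ℕ → Subset n → Set
Embeds {n} k S = Σ (Fin k → Fin n) λ g → Injective _≡_ _≡_ g × (∀ j → g j ∈ S)

embeds⇒≤ : ∀ {n k} {S : Subset n} → Embeds k S → k ≤ ∣ S ∣
embeds⇒≤ {k = zero} _ = z≤n
embeds⇒≤ {k = suc k} {S} (g , g-inj , g∈S) =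
  ≤-trans (s≤s (embeds⇒≤ {S = S - g zero} (g ∘ suc , suc-injective ∘ g-inj , rest∈)))
          (x∈p⇒∣p-x∣<∣p∣ (g∈S zero))
  where
  rest∈ : ∀ j → g (suc j) ∈ S - g zero
  rest∈ j = x∈p∧x≢y⇒x∈p-y (g∈S (suc j)) (λ eq → 0≢1+n (sym (g-inj eq)))

≤⇒embeds : ∀ {n k} {S : Subset n} → k ≤ ∣ S ∣ → Embeds k S
≤⇒embeds {k = zero} _ = (λ ()) , (λ { {()} }) , λ ()
≤⇒embeds {k = suc k} {S} k<∣S∣ with pick S k<∣S∣
... | x , x∈S , k≤ with ≤⇒embeds {S = S - x} k≤
... | g , g-inj , g∈S-x = extend , extend-inj , extend∈S
  where
  extend : Fin (suc k) → Fin _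
  extend zero = x
  extend (suc j) = g j
  g≢x : ∀ j → g j ≢ x
  g≢x j refl = x∉S-x (g∈S-x j)
  extend-inj : Injective _≡_ _≡_ extend
  extend-inj {zero} {zero} _ = refl
  extend-inj {zero} {suc j} eq = ⊥-elim (g≢x j (sym eq))
  extend-inj {suc j} {zero} eq = ⊥-elim (g≢x j eq)
  extend-inj {suc j} {suc j'} eq = cong suc (g-inj eq)
  extend∈S : ∀ j → extend j ∈ S
  extend∈S zero = x∈S
  extend∈S (suc j) = p─q⊆p S _ (g∈S-x j)

select : ∀ {n} {P : Fin n → Set} → Decidable P → Subset n
select P? = tabulate (does ∘ P?)

∈-tabulate⇔ : ∀ {n} (f : Fin n → Side) {x} → x ∈ tabulate f ⇔ f x ≡ inside
∈-tabulate⇔ f {x} = mk⇔ (λ x∈ → trans (sym (lookup∘tabulate f x)) ([]=⇒lookup x∈))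
                       (λ fx → lookup⇒[]= x _ (trans (lookup∘tabulate f x) fx))

∈-select⇔ : ∀ {n} {P : Fin n → Set} (P? : Decidable P) {x} → x ∈ select P? ⇔ P x
∈-select⇔ P? {x} = mk⇔ (λ x∈ → witness (P? x) (to (∈-tabulate⇔ _) x∈))
                         (λ Px → from (∈-tabulate⇔ _) (dec-true (P? x) Px))
  where
  witness : ∀ {A : Set} (A? : Dec A) → does A? ≡ inside → A
  witness (yes a) _ = a

Incidence : (H : Hypergraph) → Fin (n H) → Fin (m H) → Set
Incidence H v i = v ∈ edge H i

∈-dual⇔ : ∀ {H} {v i} → i ∈ edge (dual H) v ⇔ v ∈ edge H i
∈-dual⇔ {H} {v} {i} = mk⇔ (λ i∈ → lookup⇒[]= v _ (to (∈-tabulate⇔ _) i∈))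
                          (λ v∈ → from (∈-tabulate⇔ _) ([]=⇒lookup v∈))

-- Traces of size at least two of a triple {a, b, c} realised by blocks of a relation R;
-- these are the traces a shattered triple must exhibit.
record Shatters₃ {A B : Set} (R : A → B → Set) (a b c : A) : Set where
  field
    abc : ∃ λ e → R a e × R b e × R c e
    ab  : ∃ λ e → R a e × R b e × ¬ R c e
    ac  : ∃ λ e → R a e × R c e × ¬ R b e
    bc  : ∃ λ e → R b e × R c e × ¬ R a e

NoTriple : {A B : Set} → (A → B → Set) → Set
NoTriple R = ∀ {a b c} → a ≢ b → a ≢ c → b ≢ c → ¬ Shatters₃ R a b c

NoTriple-pullback : {A B A' B' : Set} {R : A → B → Set} {R' : A' → B' → Set}
  (f : A' → A) (g : B' → B) → Injective _≡_ _≡_ f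
  → (∀ {a e} → R' a e ⇔ R (f a) (g e)) → NoTriple R → NoTriple R'
NoTriple-pullback {R = R} {R'} f g f-inj R'⇔R noTriple a≢b a≢c b≢c
  record { abc = e₀ , a₀ , b₀ , c₀ ; ab = e₁ , a₁ , b₁ , c₁ ; ac = e₂ , a₂ , c₂ , b₂ ; bc = e₃ , b₃ , c₃ , a₃ } =
  noTriple (a≢b ∘ f-inj) (a≢c ∘ f-inj) (b≢c ∘ f-inj) record
    { abc = g e₀ , ⇒ a₀ , ⇒ b₀ , ⇒ c₀
    ; ab  = g e₁ , ⇒ a₁ , ⇒ b₁ , c₁ ∘ ⇐
    ; ac  = g e₂ , ⇒ a₂ , ⇒ c₂ , b₂ ∘ ⇐
    ; bc  = g e₃ , ⇒ b₃ , ⇒ c₃ , a₃ ∘ ⇐ }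
  where
  ⇒ : ∀ {a e} → R' a e → R (f a) (g e)
  ⇒ = to R'⇔R
  ⇐ : ∀ {a e} → R (f a) (g e) → R' a e
  ⇐ = from R'⇔R

trace : ∀ {H S T} → Shattered H S → T ⊆ S → ∃ λ i →
  (∀ {x} → x ∈ T → x ∈ edge H i) × (∀ {x} → x ∈ S → x ∉ T → x ∉ edge H i)
trace {H} {S} {T} shattered T⊆S with shattered T T⊆S
... | i , S∩E≡T = i , (λ x∈T → proj₂ (x∈p∩q⁻ S (edge H i) (subst (_ ∈_) (sym S∩E≡T) x∈T)))
                    , (λ x∈S x∉T x∈E → x∉T (subst (_ ∈_) S∩E≡T (x∈p∩q⁺ (x∈S , x∈E))))

-- If the incidence relation shatters no triple then no three vertices are shattered:
-- for distinct members a, b, c of S the traces S, S - c, S - b, S - a would witness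
-- a shattered triple.
vc≤2 : ∀ H → NoTriple (Incidence H) → VCdim≤ H 2
vc≤2 H noTriple S shattered with 3 ≤? ∣ S ∣
... | no ¬3≤ = ≤-pred (≰⇒> ¬3≤)
... | yes 3≤ with ≤⇒embeds {k = 3} 3≤
... | g , g-inj , g∈S = ⊥-elim (noTriple (apart 0F 1F λ ()) (apart 0F 2F λ ()) (apart 1F 2F λ ()) record
    { abc = all-three
    ; ab  = avoiding 2F 0F 1F (λ ()) (λ ())
    ; ac  = avoiding 1F 0F 2F (λ ()) (λ ())
    ; bc  = avoiding 0F 1F 2F (λ ()) (λ ()) })
  where
  apart : ∀ j j' → j ≢ j' → g j ≢ g j'
  apart j j' j≢j' = j≢j' ∘ g-inj
  all-three : ∃ λ i → g 0F ∈ edge H i × g 1F ∈ edge H i × g 2F ∈ edge H i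
  all-three with trace {T = S} shattered id
  ... | i , T⊆E , _ = i , T⊆E (g∈S 0F) , T⊆E (g∈S 1F) , T⊆E (g∈S 2F)
  avoiding : ∀ x y z → y ≢ x → z ≢ x → ∃ λ i → g y ∈ edge H i × g z ∈ edge H i × g x ∉ edge H i
  avoiding x y z y≢x z≢x with trace {T = S - g x} shattered (p─q⊆p S _)
  ... | i , T⊆E , outside-T = i , T⊆E (x∈p∧x≢y⇒x∈p-y (g∈S y) (apart y x y≢x))
                               , T⊆E (x∈p∧x≢y⇒x∈p-y (g∈S z) (apart z x z≢x))
                               , outside-T (g∈S x) x∉S-x

-- H ∈ 𝓕 follows from NoTriple for the incidence relation and for its transpose,
-- since dualising transposes incidence.
inF : ∀ H → NoTriple (Incidence H) → NoTriple (flip (Incidence H)) → InF H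
inF H noTriple noTripleᵀ =
  vc≤2 H noTriple , vc≤2 (dual H) (NoTriple-pullback id id id (∈-dual⇔ {H}) noTripleᵀ)

-- The same two hypotheses give H* ∈ 𝓕, as the two relations swap roles in H*.
inF-dual : ∀ H → NoTriple (Incidence H) → NoTriple (flip (Incidence H)) → InF (dual H)
inF-dual H noTriple noTripleᵀ = inF (dual H)
  (NoTriple-pullback id id id (∈-dual⇔ {H}) noTripleᵀ)
  (NoTriple-pullback id id id (∈-dual⇔ {H}) noTriple)

-- Degrees in H* are edge sizes of H, since H** has the incidence relation of H.
embeds-dual : ∀ {H k v} → Embeds k (edge H v) → Embeds k (edge (dual (dual H)) v)
embeds-dual {H} (g , g-inj , g∈) = g , g-inj , λ j → from (∈-dual⇔ {dual H}) (from (∈-dual⇔ {H}) (g∈ j))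

p≡1 : ∀ H → (∀ i → Nonempty (edge H i)) → (∀ {k} c → ¬ Polychromatic H (suc (suc k)) c) → p≡ H 1
p≡1 H nonempty no-colouring = (const zero , one-colour) , maximal
  where
  one-colour : Polychromatic H 1 (const zero)
  one-colour i zero with nonempty i
  ... | v , v∈ = v , v∈ , refl
  maximal : ∀ k → k ≥ 1 → k ≡ 1 ⊎ ¬ ∃ (Polychromatic H k)
  maximal 1 _ = inj₁ refl
  maximal (suc (suc k)) _ = inj₂ λ (c , polychromatic) → no-colouring c polychromatic

cover⇔polychromatic : ∀ {H k f} → CoverPartition (dual H) k f ⇔ Polychromatic H k f
cover⇔polychromatic {H} = mk⇔
  (λ cover i j → Product.map₂ (λ (fv , i∈) → to (∈-dual⇔ {H}) i∈ , fv) (cover j i))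
  (λ poly j i → Product.map₂ (λ (v∈ , fv) → fv , from (∈-dual⇔ {H}) v∈) (poly i j))

p'-dual : ∀ {H k} → p≡ H k → p'≡ (dual H) k
p'-dual {H} ((c , polychromatic) , maximal) =
  (c , from cover⇔polychromatic polychromatic)
  , λ k' k'≥k → Sum.map₂ (λ ¬poly (f , cover) → ¬poly (f , to cover⇔polychromatic cover)) (maximal k' k'≥k)

module CompleteTree (b : ℕ) where

  -- Nodes of the complete b-ary tree of depth D: `step k x` descends from the root
  -- to its k-th child and then follows the path x inside that subtree.
  data Node : ℕ → Set where
    root : ∀ {D} → Node D
    step : ∀ {D} → Fin b → Node D → Node (suc D)

  private variable
    D : ℕ
    k : Fin b
    x y z e e' l : Node D

  step-injective : step k x ≡ step k y → x ≡ y
  step-injective refl = refl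

  -- The leaves are the nodes at depth exactly D.
  data Leaf : Node D → Set where
    root : Leaf {zero} root
    step : Leaf x → Leaf (step k x)

  data _≼_ : Node D → Node D → Set where
    root : root ≼ y
    step : x ≼ y → step k x ≼ step k y

  data _⋖_ : Node D → Node D → Set where
    root : step k (root {D}) ⋖ root
    step : x ⋖ y → step k x ⋖ step k y

  data _∈ᵀ_ (x e : Node D) : Set where
    on-path  : Leaf e → x ≼ e → x ∈ᵀ e
    child-of : ¬ Leaf e → x ⋖ e → x ∈ᵀ e

  on-path⁻ : Leaf e → x ∈ᵀ e → x ≼ e
  on-path⁻ _ (on-path _ x≼e) = x≼e
  on-path⁻ leaf (child-of ¬leaf _) = ⊥-elim (¬leaf leaf)

  child-of⁻ : ¬ Leaf e → x ∈ᵀ e → x ⋖ e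
  child-of⁻ ¬leaf (on-path leaf _) = ⊥-elim (¬leaf leaf)
  child-of⁻ _ (child-of _ x⋖e) = x⋖e

  leaf? : (x : Node D) → Dec (Leaf x)
  leaf? {zero} root = yes root
  leaf? {suc D} root = no λ ()
  leaf? (step k x) = map′ step (λ { (step leaf) → leaf }) (leaf? x)

  _≼?_ : (x y : Node D) → Dec (x ≼ y)
  root ≼? y = yes root
  step k x ≼? root = no λ ()
  step k x ≼? step k' y with k ≟ k'
  ... | no k≢k' = no λ { (step _) → k≢k' refl }
  ... | yes refl = map′ step (λ { (step x≼y) → x≼y }) (x ≼? y)

  _⋖?_ : (x y : Node D) → Dec (x ⋖ y)
  root ⋖? y = no λ ()
  step k root ⋖? root = yes root
  step k (step _ _) ⋖? root = no λ ()
  step k x ⋖? step k' y with k ≟ k'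
  ... | no k≢k' = no λ { (step _) → k≢k' refl }
  ... | yes refl = map′ step (λ { (step x⋖y) → x⋖y }) (x ⋖? y)

  _∈ᵀ?_ : (x e : Node D) → Dec (x ∈ᵀ e)
  x ∈ᵀ? e with leaf? e
  ... | yes leaf = map′ (on-path leaf) (on-path⁻ leaf) (x ≼? e)
  ... | no ¬leaf = map′ (child-of ¬leaf) (child-of⁻ ¬leaf) (x ⋖? e)

  ≼-refl : x ≼ x
  ≼-refl {x = root} = root
  ≼-refl {x = step k x} = step ≼-refl

  ≼-trans : x ≼ y → y ≼ z → x ≼ z
  ≼-trans root _ = root
  ≼-trans (step x≼y) (step y≼z) = step (≼-trans x≼y y≼z)

  ≼-chain : x ≼ z → y ≼ z → x ≼ y ⊎ y ≼ x
  ≼-chain root _ = inj₁ root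
  ≼-chain (step _) root = inj₂ root
  ≼-chain (step x≼z) (step y≼z) = Sum.map step step (≼-chain x≼z y≼z)

  parent-unique : x ⋖ y → x ⋖ z → y ≡ z
  parent-unique root root = refl
  parent-unique root (step ())
  parent-unique (step ()) root
  parent-unique (step x⋖y) (step x⋖z) = cong (step _) (parent-unique x⋖y x⋖z)

  siblings-on-path : x ⋖ e → y ⋖ e → x ≼ l → y ≼ l → x ≡ y
  siblings-on-path root root (step _) (step _) = refl
  siblings-on-path (step x⋖e) (step y⋖e) (step x≼l) (step y≼l) =
    cong (step _) (siblings-on-path x⋖e y⋖e x≼l y≼l)

  -- An edge holding two comparable vertices holds everything between them: a path is
  -- closed under ancestors, and a children set holds no two comparable nodes.
  between : x ≼ y → y ≼ z → x ≢ z → x ∈ᵀ e → z ∈ᵀ e → y ∈ᵀ e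
  between _ y≼z _ (on-path leaf _) z∈e = on-path leaf (≼-trans y≼z (on-path⁻ leaf z∈e))
  between x≼y y≼z x≢z (child-of ¬leaf x⋖e) z∈e =
    ⊥-elim (x≢z (siblings-on-path x⋖e (child-of⁻ ¬leaf z∈e) (≼-trans x≼y y≼z) ≼-refl))

  no-gap : x ≼ y → y ≼ z → x ≢ z → ¬ ∃ λ e → x ∈ᵀ e × z ∈ᵀ e × ¬ y ∈ᵀ e
  no-gap x≼y y≼z x≢z (_ , x∈ , z∈ , y∉) = y∉ (between x≼y y≼z x≢z x∈ z∈)

  no-gap′ : z ≼ y → y ≼ x → x ≢ z → ¬ ∃ λ e → x ∈ᵀ e × z ∈ᵀ e × ¬ y ∈ᵀ e
  no-gap′ z≼y y≼x x≢z (_ , x∈ , z∈ , y∉) = y∉ (between z≼y y≼x (x≢z ∘ sym) z∈ x∈)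

  -- Three distinct ancestors of one node form a chain; the edge meant to hold the two
  -- outer ones but not the middle one cannot exist.
  chain-noTriple : ∀ {a b c : Node D} → a ≼ l → b ≼ l → c ≼ l
    → a ≢ b → a ≢ c → b ≢ c → ¬ Shatters₃ _∈ᵀ_ a b c
  chain-noTriple a≼l b≼l c≼l a≢b a≢c b≢c record { ab = ab ; ac = ac ; bc = bc }
    with ≼-chain a≼l b≼l | ≼-chain b≼l c≼l | ≼-chain a≼l c≼l
  ... | inj₁ a≼b | inj₁ b≼c | _        = no-gap a≼b b≼c a≢c ac
  ... | inj₁ a≼b | inj₂ c≼b | inj₁ a≼c = no-gap a≼c c≼b a≢b ab
  ... | inj₁ a≼b | inj₂ c≼b | inj₂ c≼a = no-gap′ c≼a a≼b b≢c bc
  ... | inj₂ b≼a | _        | inj₁ a≼c = no-gap b≼a a≼c b≢c bc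
  ... | inj₂ b≼a | inj₁ b≼c | inj₂ c≼a = no-gap′ b≼c c≼a a≢b ab
  ... | inj₂ b≼a | inj₂ c≼b | inj₂ c≼a = no-gap′ c≼b b≼a a≢c ac

  siblings-edge : x ⋖ e → y ⋖ e → x ≢ y → x ∈ᵀ e' → y ∈ᵀ e' → e' ≡ e
  siblings-edge x⋖e y⋖e x≢y (on-path leaf x≼e') y∈e' =
    ⊥-elim (x≢y (siblings-on-path x⋖e y⋖e x≼e' (on-path⁻ leaf y∈e')))
  siblings-edge x⋖e _ _ (child-of _ x⋖e') _ = parent-unique x⋖e' x⋖e

  -- If the edge holding a, b, c is a path, they form a chain; if it is a children
  -- set, it is the only edge holding both a and b, yet it also holds c.
  ∈ᵀ-noTriple : NoTriple (_∈ᵀ_ {D})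
  ∈ᵀ-noTriple a≢b a≢c b≢c t@record { abc = e , a∈ , b∈ , c∈ ; ab = e' , a∈' , b∈' , c∉' }
    with leaf? e
  ... | yes leaf = chain-noTriple (on-path⁻ leaf a∈) (on-path⁻ leaf b∈) (on-path⁻ leaf c∈) a≢b a≢c b≢c t
  ... | no ¬leaf = c∉' (subst (_ ∈ᵀ_) (sym e'≡e) c∈)
    where
    e'≡e = siblings-edge (child-of⁻ ¬leaf a∈) (child-of⁻ ¬leaf b∈) a≢b a∈' b∈'

  -- Distinct inner edges are disjoint, since every node has one parent.
  inner-edges-disjoint : ¬ Leaf e → ¬ Leaf e' → x ∈ᵀ e → x ∈ᵀ e' → e ≡ e'
  inner-edges-disjoint ¬leaf ¬leaf' x∈e x∈e' = parent-unique (child-of⁻ ¬leaf x∈e) (child-of⁻ ¬leaf' x∈e')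

  -- Paths e, e', e'': a vertex of e ∩ e' outside e'' and a vertex of e ∩ e'' outside e'
  -- are comparable, and the lower one lies on both other paths.
  paths-noTriple : ∀ {e''} → Leaf e → Leaf e' → Leaf e''
    → (∃ λ x → x ∈ᵀ e × x ∈ᵀ e' × ¬ x ∈ᵀ e'') → ¬ ∃ λ y → y ∈ᵀ e × y ∈ᵀ e'' × ¬ y ∈ᵀ e'
  paths-noTriple leaf leaf' leaf'' (x , x∈ , x∈' , x∉'') (y , y∈ , y∈'' , y∉')
    with ≼-chain (on-path⁻ leaf x∈) (on-path⁻ leaf y∈)
  ... | inj₁ x≼y = x∉'' (on-path leaf'' (≼-trans x≼y (on-path⁻ leaf'' y∈'')))
  ... | inj₂ y≼x = y∉' (on-path leaf' (≼-trans y≼x (on-path⁻ leaf' x∈')))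

  -- A path p and an inner edge i through a common vertex v: any other vertex u of p ∩ i
  -- is a sibling of v on the path p, hence u = v, so u lies in every edge through v.
  path-inner-noTriple : ∀ {p i q v : Node D} → Leaf p → ¬ Leaf i → v ∈ᵀ p → v ∈ᵀ q → v ∈ᵀ i
    → ¬ ∃ λ u → u ∈ᵀ p × u ∈ᵀ i × ¬ u ∈ᵀ q
  path-inner-noTriple leaf ¬leaf v∈p v∈q v∈i (u , u∈p , u∈i , u∉q) =
    u∉q (subst (_∈ᵀ _) v≡u v∈q)
    where
    v≡u = siblings-on-path (child-of⁻ ¬leaf v∈i) (child-of⁻ ¬leaf u∈i)
                           (on-path⁻ leaf v∈p) (on-path⁻ leaf u∈p)

  -- Three edges through a common vertex v include at most one inner edge, since inner
  -- edges are disjoint; the remaining cases are settled by the two lemmas above.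
  ∈ᵀ-dual-noTriple : NoTriple (flip (_∈ᵀ_ {D}))
  ∈ᵀ-dual-noTriple {a = e₁} {b = e₂} {c = e₃} e₁≢e₂ e₁≢e₃ e₂≢e₃
    record { abc = v , v∈₁ , v∈₂ , v∈₃ ; ab = u , u∈₁ , u∈₂ , u∉₃ ; ac = ac }
    with leaf? e₁ | leaf? e₂ | leaf? e₃
  ... | yes leaf₁ | yes leaf₂ | yes leaf₃ = paths-noTriple leaf₁ leaf₂ leaf₃ (u , u∈₁ , u∈₂ , u∉₃) ac
  ... | yes leaf₁ | yes _     | no ¬leaf₃ = path-inner-noTriple leaf₁ ¬leaf₃ v∈₁ v∈₂ v∈₃ ac
  ... | yes leaf₁ | no ¬leaf₂ | yes _     = path-inner-noTriple leaf₁ ¬leaf₂ v∈₁ v∈₃ v∈₂ (u , u∈₁ , u∈₂ , u∉₃)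
  ... | no ¬leaf₁ | yes leaf₂ | yes _     = path-inner-noTriple leaf₂ ¬leaf₁ v∈₂ v∈₃ v∈₁ (u , u∈₂ , u∈₁ , u∉₃)
  ... | yes _     | no ¬leaf₂ | no ¬leaf₃ = e₂≢e₃ (inner-edges-disjoint ¬leaf₂ ¬leaf₃ v∈₂ v∈₃)
  ... | no ¬leaf₁ | yes _     | no ¬leaf₃ = e₁≢e₃ (inner-edges-disjoint ¬leaf₁ ¬leaf₃ v∈₁ v∈₃)
  ... | no ¬leaf₁ | no ¬leaf₂ | _         = e₁≢e₂ (inner-edges-disjoint ¬leaf₁ ¬leaf₂ v∈₁ v∈₂)

  -- `truncate j x` is the ancestor of x at depth j (or x itself when shallower).
  truncate : Fin (suc D) → Node D → Node D
  truncate zero x = root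
  truncate {suc D} (suc j) root = root
  truncate {suc D} (suc j) (step k x) = step k (truncate j x)

  truncate-≼ : ∀ (j : Fin (suc D)) x → truncate j x ≼ x
  truncate-≼ zero x = root
  truncate-≼ {suc D} (suc j) root = root
  truncate-≼ {suc D} (suc j) (step k x) = step (truncate-≼ j x)

  truncate-injective : Leaf l → Injective _≡_ _≡_ (λ j → truncate j l)
  truncate-injective root {zero} {zero} _ = refl
  truncate-injective (step leaf) {zero} {zero} _ = refl
  truncate-injective (step leaf) {suc j} {suc j'} eq = cong suc (truncate-injective leaf (step-injective eq))

  child : Fin b → Node D → Node D
  child {zero} k root = root
  child {suc D} k root = step k root
  child k (step k' x) = step k' (child k x)

  child-⋖ : ¬ Leaf x → child k x ⋖ x
  child-⋖ {zero} {root} ¬leaf = ⊥-elim (¬leaf root)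
  child-⋖ {suc D} {root} ¬leaf = root
  child-⋖ {x = step k' x} ¬leaf = step (child-⋖ (¬leaf ∘ step))

  child-injective : ¬ Leaf x → Injective _≡_ _≡_ (λ k → child k x)
  child-injective {zero} {root} ¬leaf _ = ⊥-elim (¬leaf root)
  child-injective {suc D} {root} ¬leaf refl = refl
  child-injective {x = step k' x} ¬leaf eq = child-injective (¬leaf ∘ step) (step-injective eq)

  members : ∀ {s} → s ≤ b → s ≤ suc D → (e : Node D)
    → Σ (Fin s → Node D) λ g → Injective _≡_ _≡_ g × (∀ j → g j ∈ᵀ e)
  members s≤b s≤D+1 e with leaf? e
  ... | yes leaf = (λ j → truncate (inject≤ j s≤D+1) e)
                 , inject≤-injective s≤D+1 s≤D+1 _ _ ∘ truncate-injective leaf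
                 , λ j → on-path leaf (truncate-≼ _ e)
  ... | no ¬leaf = (λ j → child (inject≤ j s≤b) e)
                 , inject≤-injective s≤b s≤b _ _ ∘ child-injective ¬leaf
                 , λ j → child-of ¬leaf (child-⋖ ¬leaf)

  monochromatic-path : ∀ {C : Set} (col : Node D → C) (γ : C) → col root ≡ γ
    → (∀ x → ¬ Leaf x → ∃ λ y → y ⋖ x × col y ≡ γ)
    → ∃ λ l → Leaf l × ∀ x → x ≼ l → col x ≡ γ
  monochromatic-path {zero} col γ root-γ _ = root , root , λ { root _ → root-γ }
  monochromatic-path {suc D} col γ root-γ γ-child with γ-child root (λ ())
  ... | step k root , root , child-γ with monochromatic-path (col ∘ step k) γ child-γ γ-child-below
    where
    γ-child-below : ∀ x → ¬ Leaf x → ∃ λ y → y ⋖ x × col (step k y) ≡ γ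
    γ-child-below x ¬leaf with γ-child (step k x) (¬leaf ∘ λ { (step leaf) → leaf })
    ... | step _ y , step y⋖x , y-γ = y , y⋖x , y-γ
  ... | l , leaf , path-γ =
    step k l , step leaf , λ { root _ → root-γ ; (step _ x) (step x≼l) → path-γ x x≼l }

  -- Enumeration of the nodes by Fin (size D): the root first, then the subtrees in order.
  size : ℕ → ℕ
  size zero = 1
  size (suc D) = suc (b * size D)

  node : Fin (size D) → Node D
  node {zero} _ = root
  node {suc D} zero = root
  node {suc D} (suc u) = descend (remQuot {b} (size D) u)
    where
    descend : Fin b × Fin (size D) → Node (suc D)
    descend p = step (proj₁ p) (node (proj₂ p))

  index : Node D → Fin (size D)
  index {zero} root = zero
  index {suc D} root = zero
  index (step k x) = suc (combine k (index x))

  node-index : (x : Node D) → node (index x) ≡ x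
  node-index {zero} root = refl
  node-index {suc D} root = refl
  node-index {suc D} (step k x) =
    trans (cong (λ p → step (proj₁ p) (node (proj₂ p))) (remQuot-combine {b} k (index x)))
          (cong (step k) (node-index x))

  index-node : (u : Fin (size D)) → index (node {D} u) ≡ u
  index-node {zero} zero = refl
  index-node {suc D} zero = refl
  index-node {suc D} (suc u) = cong suc (begin
    combine branch (index (node rest))  ≡⟨ cong (combine branch) (index-node rest) ⟩
    combine branch rest                 ≡⟨ combine-remQuot {b} (size D) u ⟩
    u ∎)
    where
    open ≡-Reasoning
    branch = proj₁ (remQuot {b} (size D) u)
    rest = proj₂ (remQuot {b} (size D) u)

  node-injective : Injective _≡_ _≡_ (node {D})
  node-injective {x = u} {v} eq = trans (sym (index-node u)) (trans (cong index eq) (index-node v))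

  index-injective : Injective _≡_ _≡_ (index {D})
  index-injective {x = x} {y} eq = trans (sym (node-index x)) (trans (cong node eq) (node-index y))

  tree : ℕ → Hypergraph
  tree D = hyp (size D) (size D) (λ i → select (λ u → node u ∈ᵀ? node i))

  ∈-tree⇔ : ∀ {u i} → u ∈ edge (tree D) i ⇔ node u ∈ᵀ node i
  ∈-tree⇔ {D} {i = i} = ∈-select⇔ (λ u → node u ∈ᵀ? node {D} i)

  tree-noTriple : NoTriple (Incidence (tree D))
  tree-noTriple = NoTriple-pullback node node node-injective ∈-tree⇔ ∈ᵀ-noTriple

  tree-noTripleᵀ : NoTriple (flip (Incidence (tree D)))
  tree-noTripleᵀ = NoTriple-pullback node node node-injective ∈-tree⇔ ∈ᵀ-dual-noTriple

  tree-embeds : ∀ {s} → s ≤ b → s ≤ suc D → ∀ i → Embeds s (edge (tree D) i)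
  tree-embeds s≤b s≤D+1 i with members s≤b s≤D+1 (node i)
  ... | g , g-inj , g∈ = index ∘ g , g-inj ∘ index-injective
                       , λ j → from ∈-tree⇔ (subst (_∈ᵀ node i) (sym (node-index (g j))) (g∈ j))

  -- A polychromatic colouring c with at least two colours would give every inner node a
  -- child of the root's colour γ; the monochromatic path so obtained is an edge missing
  -- any other colour.
  tree-no-polychromatic : ∀ {k} c → ¬ Polychromatic (tree D) (suc (suc k)) c
  tree-no-polychromatic {D} c polychromatic = misses-colour (monochromatic-path col γ refl γ-child)
    where
    col = c ∘ index
    γ = col root
    col-node : ∀ u → col (node u) ≡ c u
    col-node u = cong c (index-node u)
    member : ∀ {u} x → u ∈ edge (tree D) (index x) → node u ∈ᵀ x
    member x u∈ = subst (_ ∈ᵀ_) (node-index x) (to ∈-tree⇔ u∈)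
    γ-child : ∀ x → ¬ Leaf x → ∃ λ y → y ⋖ x × col y ≡ γ
    γ-child x ¬leaf with polychromatic (index x) γ
    ... | u , u∈ , cu≡γ = node u , child-of⁻ ¬leaf (member x u∈) , trans (col-node u) cu≡γ
    misses-colour : ¬ ∃ λ l → Leaf l × ∀ x → x ≼ l → col x ≡ γ
    misses-colour (l , leaf , path-γ) with polychromatic (index l) (punchIn γ zero)
    ... | u , u∈ , cu≡other = punchInᵢ≢i γ zero (begin
      punchIn γ zero  ≡⟨ sym cu≡other ⟩
      c u             ≡⟨ sym (col-node u) ⟩
      col (node u)    ≡⟨ path-γ (node u) (on-path⁻ leaf (member l u∈)) ⟩
      γ               ∎)
      where open ≡-Reasoning

  -- With at least one branch every edge is nonempty, so p = 1.
  tree-p≡1 : 1 ≤ b → p≡ (tree D) 1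
  tree-p≡1 1≤b = p≡1 (tree _) nonempty tree-no-polychromatic
    where
    nonempty : ∀ i → Nonempty (edge (tree _) i)
    nonempty i with tree-embeds 1≤b (s≤s z≤n) i
    ... | g , _ , g∈ = g zero , g∈ zero

-- Second part: the dual of
-- the tree hypergraph with branching and depth δ, whose degrees are the edge sizes of the
-- tree and whose p' is the tree's p.
theorem7 : ((r : ℕ) → r ≥ 1 → Σ Hypergraph λ H → InF H × ((i : Fin (m H)) → ∣ edge H i ∣ ≥ r) × p≡ H 1)
    × ((δ : ℕ) → δ ≥ 1 → Σ Hypergraph λ H → InF H × ((v : Fin (n H)) → degree H v ≥ δ) × p'≡ H 1)
theorem7 = first , second
  where
  first : (r : ℕ) → r ≥ 1 → Σ Hypergraph λ H → InF H × ((i : Fin (m H)) → ∣ edge H i ∣ ≥ r) × p≡ H 1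
  first r r≥1 = tree r
              , inF (tree r) tree-noTriple tree-noTripleᵀ
              , (λ i → embeds⇒≤ (tree-embeds ≤-refl (n≤1+n r) i))
              , tree-p≡1 r≥1
    where open CompleteTree r

  second : (δ : ℕ) → δ ≥ 1 → Σ Hypergraph λ H → InF H × ((v : Fin (n H)) → degree H v ≥ δ) × p'≡ H 1
  second δ δ≥1 = dual (tree δ)
               , inF-dual (tree δ) tree-noTriple tree-noTripleᵀ
               , (λ v → embeds⇒≤ (embeds-dual {tree δ} (tree-embeds ≤-refl (n≤1+n δ) v)))
               , p'-dual (tree-p≡1 δ≥1)
    where open CompleteTree δ
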